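{- Let $N\ge 2$ and write $N=2r$ or $N=2r+1$ with $r$ an integer. Every quiver $Q$ on $N$ nodes which has period $1$ (i.e. $\mu_1B_Q=\rho B_Q\rho^{ -1}$) and for which node $1$ is a sink has matrix of the form $B_Q=\sum_{k=1}^r m_k B_N^{(k)}$, where the $m_k$ are nonnegative integers.
   Context: A quiver on nodes $1,\dots,N$ (no loops, no $2$-cycles) is identified with the skew-symmetric integer matrix $B=(b_{ij})$, $b_{ij}$ = number of arrows $i\to j$ minus number of arrows $j\to i$. Mutation at $k$: $\mu_kB=\tilde B$ with $\tilde b_{ij}=-b_{ij}$ if $i=k$ or $j=k$, and $\tilde b_{ij}=b_{ij}+\frac12(|b_{ik}|b_{kj}+b_{ik}|b_{kj}|)$ otherwise. $\rho$ is the permutation matrix with $\rho_{i+1,i}=1$ ($1\le i\le N-1$), $\rho_{1,N}=1$, other entries $0$. $\tau$ is the matrix with $\tau_{i+1,i}=1$ ($1\le i\le N-1$), $\tau_{1,N}=-1$, other entries $0$. Node $i$ is a sink if $b_{ij}\le 0$ for all $j$. For $1\le k\le r$, $R_N^{(k)}$ is the skew-symmetric matrix with $(R_N^{(k)})_{N-k+1,1}=1$, $(R_N^{(k)})_{1,N-k+1}=-1$ and all other entries $0$. The period $1$ primitives are $B_N^{(k)}=\sum_{i=0}^{N-1}\tau^iR_N^{(k)}\tau^{ -i}$ if $N=2r+1$ and $1\le k\le r$, or if $N=2r$ and $1\le k\le r-1$; and $B_{2r}^{(r)}=\sum_{i=0}^{r-1}\tau^iR_{2r}^{(r)}\tau^{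 -i}$. -}

module Defs where

open import Data.Nat as ℕ using (ℕ; zero; suc; _∸_; _≡ᵇ_)
open import Data.Fin using (Fin; zero; suc; toℕ)
open import Data.Integer as ℤ using (ℤ; +_; -_; _+_; _*_; ∣_∣; _/ℕ_)
open import Data.Bool using (Bool; true; false; if_then_else_; _∧_; _∨_)

-- Nodes 1..N are represented by Fin N; node p corresponds to the
-- element with toℕ = p - 1.

Mat : ℕ → Set
Mat N = Fin N → Fin N → ℤ

sumFin : ∀ {n} → (Fin n → ℤ) → ℤ
sumFin {zero}  f = + 0
sumFin {suc n} f = f zero + sumFin (λ i → f (suc i))

_⊗_ : ∀ {N} → Mat N → Mat N → Mat N
(A ⊗ B) i j = sumFin (λ l → A i l * B l j)

_⊕_ : ∀ {N} → Mat N → Mat N → Mat N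
(A ⊕ B) i j = A i j + B i j

zeroMat : ∀ {N} → Mat N
zeroMat i j = + 0

idMat : ∀ {N} → Mat N
idMat i j = if toℕ i ≡ᵇ toℕ j then + 1 else + 0

transpose : ∀ {N} → Mat N → Mat N
transpose A i j = A j i

matPow : ∀ {N} → Mat N → ℕ → Mat N
matPow A zero    = idMat
matPow A (suc n) = A ⊗ matPow A n

sumMat : ∀ {N} → ℕ → (ℕ → Mat N) → Mat N
sumMat zero    F = zeroMat
sumMat (suc n) F = sumMat n F ⊕ F n

-- Skew-symmetric integer matrix (= quiver without loops and 2-cycles).
SkewSymmetric : ∀ {N} → Mat N → Set
SkewSymmetric B = ∀ i j → B j i ≡ - B i j
  where open import Relation.Binary.PropositionalEquality using (_≡_)

absℤ : ℤ → ℤ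
absℤ x = + ∣ x ∣

μ : ∀ {N} → Fin N → Mat N → Mat N
μ k B i j =
  if (toℕ i ≡ᵇ toℕ k) ∨ (toℕ j ≡ᵇ toℕ k)
  then - B i j
  else B i j + ((absℤ (B i k) * B k j + B i k * absℤ (B k j)) /ℕ 2)

ρ : ∀ {N} → Mat N
ρ {N} i j =
  if (toℕ i ≡ᵇ suc (toℕ j)) then + 1
  else if ((toℕ i ≡ᵇ 0) ∧ (toℕ j ≡ᵇ (N ∸ 1))) then + 1
  else + 0

-- ρ is a permutation matrix, so ρ⁻¹ = ρᵀ.
ρ⁻¹ : ∀ {N} → Mat N
ρ⁻¹ = transpose ρ

τ : ∀ {N} → Mat N
τ {N} i j =
  if (toℕ i ≡ᵇ suc (toℕ j)) then + 1
  else if ((toℕ i ≡ᵇ 0) ∧ (toℕ j ≡ᵇ (N ∸ 1))) then - (+ 1)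
  else + 0

-- τ is a signed permutation matrix, so τ⁻¹ = τᵀ.
τ⁻¹ : ∀ {N} → Mat N
τ⁻¹ = transpose τ

R : (N k : ℕ) → Mat N
R N k i j =
  if (toℕ i ≡ᵇ (N ∸ k)) ∧ (toℕ j ≡ᵇ 0) then + 1
  else if (toℕ i ≡ᵇ 0) ∧ (toℕ j ≡ᵇ (N ∸ k)) then - (+ 1)
  else + 0

conjSum : (N k m : ℕ) → Mat N
conjSum N k m = sumMat m (λ i → (matPow τ i ⊗ R N k) ⊗ matPow τ⁻¹ i)

half : ℕ → ℕ
half N = N ℕ./ 2

Bprim : (N k : ℕ) → Mat N
Bprim N k =
  if ((N ℕ.% 2) ≡ᵇ 0) ∧ (k ≡ᵇ half N)
  then conjSum N k (half N)
  else conjSum N k N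

-- Because node 1 is a sink, the correction term of μ₁ vanishes away from node 1: μ₁ only
-- reverses the arrows at node 1. Conjugation by ρ moves every entry one step down the
-- diagonal, so period 1 makes B a skew-symmetric Toeplitz matrix, b_{a,b} = c(a − b) for
-- b < a, and the wrap-around row gives c(d) = c(N − d); the sink condition gives c ≥ 0.
-- On the other side τ^i is the cyclic shift by i with a sign on wrapped indices, so below
-- the diagonal τ^i R_N^{(k)} τ^{-i} has its only 1s at positions (i + N − k, i) and (i, i − k),
-- and summing over i shows that B_N^{(k)} has a 1 exactly where a − b ∈ {k, N − k}.
-- Hence m_k = c(k).

module Submission where

open import Defs
open import Data.Nat using (ℕ; suc)
open import Data.Fin using (Fin; zero; toℕ)
open import Data.Integer using (ℤ; +_; _*_; _≤_)
open import Data.Product using (∃)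
open import Relation.Binary.PropositionalEquality using (_≡_)

open import Data.Nat as ℕ
  using (zero; _∸_; _≡ᵇ_; _≤ᵇ_; _<ᵇ_; z≤n; s≤s)
  renaming (_+_ to _+ₙ_; _*_ to _*ₙ_; _≤_ to _≤ₙ_; _<_ to _<ₙ_)
import Data.Nat.Properties as ℕₚ
import Data.Nat.DivMod as ℕ
import Data.Nat.Tactic.RingSolver as ℕ-Solver
open import Data.Fin using (suc; fromℕ; fromℕ<; inject₁)
import Data.Fin.Properties as Finₚ
open import Data.Integer as ℤ using (-_; _+_; ∣_∣; _/ℕ_)
import Data.Integer.Properties as ℤₚ
open import Data.Integer.Tactic.RingSolver using (solve-∀)
open import Algebra.Properties.CommutativeSemigroup ℤₚ.+-commutativeSemigroup
  using () renaming (interchange to +-interchange)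
open import Data.Bool using (Bool; true; false; T; if_then_else_; _∧_; _∨_)
open import Data.Bool.Properties using (∧-zeroʳ; ∨-zeroʳ)
open import Data.Empty using (⊥-elim)
open import Data.Sum using (_⊎_; inj₁; inj₂)
open import Data.Product using (_,_; _×_)
open import Function using (_∘_; case_of_)
open import Relation.Binary.Definitions using (tri<; tri≈; tri>)
open import Relation.Nullary using (yes; no)
open import Relation.Nullary.Decidable using (dec-true; dec-false)
open import Relation.Binary.PropositionalEquality
  using (refl; sym; trans; cong; cong₂; subst; _≢_; ≢-sym; module ≡-Reasoning)

module _ {m n : ℕ} where

  ≡ᵇ-true : m ≡ n → (m ≡ᵇ n) ≡ true
  ≡ᵇ-true = dec-true (m ℕ.≟ n)

  ≡ᵇ-false : m ≢ n → (m ≡ᵇ n) ≡ false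
  ≡ᵇ-false = dec-false (m ℕ.≟ n)

  ≡ᵇ-true⇒≡ : (m ≡ᵇ n) ≡ true → m ≡ n
  ≡ᵇ-true⇒≡ e = ℕₚ.≡ᵇ⇒≡ m n (subst T (sym e) _)

  ≤ᵇ-true : m ≤ₙ n → (m ≤ᵇ n) ≡ true
  ≤ᵇ-true = dec-true (m ℕ.≤? n)

  ≤ᵇ-false : n <ₙ m → (m ≤ᵇ n) ≡ false
  ≤ᵇ-false n<m = dec-false (m ℕ.≤? n) (ℕₚ.<⇒≱ n<m)

  <ᵇ-true : m <ₙ n → (m <ᵇ n) ≡ true
  <ᵇ-true = dec-true (m ℕ.<? n)

  <ᵇ-false : n ≤ₙ m → (m <ᵇ n) ≡ false
  <ᵇ-false n≤m = dec-false (m ℕ.<? n) (ℕₚ.≤⇒≯ n≤m)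

≡ᵇ-cong : ∀ {m n p q} → (m ≡ n → p ≡ q) → (p ≡ q → m ≡ n) → (m ≡ᵇ n) ≡ (p ≡ᵇ q)
≡ᵇ-cong {m} {n} to from with m ℕ.≟ n
... | yes m≡n = trans (≡ᵇ-true m≡n) (sym (≡ᵇ-true (to m≡n)))
... | no m≢n  = trans (≡ᵇ-false m≢n) (sym (≡ᵇ-false (m≢n ∘ from)))

𝟙 : Bool → ℤ
𝟙 b = if b then + 1 else + 0

sumFin-cong : ∀ {n} {f g : Fin n → ℤ} → (∀ l → f l ≡ g l) → sumFin f ≡ sumFin g
sumFin-cong {zero}  f≗g = refl
sumFin-cong {suc n} f≗g = cong₂ _+_ (f≗g zero) (sumFin-cong (f≗g ∘ suc))

sumFin-zero : ∀ {n} (f : Fin n → ℤ) → (∀ l → f l ≡ + 0) → sumFin f ≡ + 0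
sumFin-zero {zero}  f f≗0 = refl
sumFin-zero {suc n} f f≗0 rewrite f≗0 zero | sumFin-zero (f ∘ suc) (f≗0 ∘ suc) = refl

sumFin-neg : ∀ {n} (f : Fin n → ℤ) → sumFin (λ l → - f l) ≡ - sumFin f
sumFin-neg {zero}  f = refl
sumFin-neg {suc n} f =
  trans (cong (λ s → - f zero + s) (sumFin-neg (f ∘ suc))) (sym (ℤₚ.neg-distrib-+ (f zero) _))

sumFin-single : ∀ {n} (f : Fin n → ℤ) l₀ → (∀ l → l ≢ l₀ → f l ≡ + 0) → sumFin f ≡ f l₀
sumFin-single {suc n} f zero others
  rewrite sumFin-zero (f ∘ suc) (λ l → others (suc l) (λ ())) = ℤₚ.+-identityʳ (f zero)
sumFin-single {suc n} f (suc l₀) others rewrite others zero (λ ()) =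
  trans (ℤₚ.+-identityˡ _)
        (sumFin-single (f ∘ suc) l₀ (λ l l≢l₀ → others (suc l) (l≢l₀ ∘ Finₚ.suc-injective)))

sumFin-singleℕ : ∀ {n} (F : ℕ → ℤ) v → v <ₙ n → (∀ u → u <ₙ n → u ≢ v → F u ≡ + 0) →
                 sumFin {n} (F ∘ toℕ) ≡ F v
sumFin-singleℕ F v v<n others =
  trans (sumFin-single (F ∘ toℕ) (fromℕ< v<n) λ l l≢v →
           others (toℕ l) (Finₚ.toℕ<n l) λ e → l≢v (Finₚ.toℕ-injective (trans e (sym toℕ-v))))
        (cong F toℕ-v)
  where toℕ-v = Finₚ.toℕ-fromℕ< v<n

sumFin-pickRow : ∀ {n} (F : ℕ → ℤ) v s → v <ₙ n →
                 sumFin {n} (λ x → (if toℕ x ≡ᵇ v then s else + 0) * F (toℕ x)) ≡ s * F v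
sumFin-pickRow F v s v<n =
  trans (sumFin-singleℕ (λ u → (if u ≡ᵇ v then s else + 0) * F u) v v<n
           (λ u _ u≢v → cong (λ b → (if b then s else + 0) * F u) (≡ᵇ-false u≢v)))
        (cong (λ b → (if b then s else + 0) * F v) (≡ᵇ-true {v} refl))

sumFin-pickCol : ∀ {n} (F : ℕ → ℤ) v s → v <ₙ n →
                 sumFin {n} (λ x → F (toℕ x) * (if toℕ x ≡ᵇ v then s else + 0)) ≡ F v * s
sumFin-pickCol {n} F v s v<n =
  trans (sumFin-cong {n} (λ x → ℤₚ.*-comm (F (toℕ x)) (if toℕ x ≡ᵇ v then s else + 0)))
        (trans (sumFin-pickRow F v s v<n) (ℤₚ.*-comm s (F v)))

sumBelow : ℕ → (ℕ → ℤ) → ℤ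
sumBelow zero    g = + 0
sumBelow (suc m) g = sumBelow m g + g m

sumMat-apply : ∀ {N} m (F : ℕ → Mat N) a b → sumMat m F a b ≡ sumBelow m (λ i → F i a b)
sumMat-apply zero    F a b = refl
sumMat-apply (suc m) F a b = cong (_+ F m a b) (sumMat-apply m F a b)

sumBelow-cong : ∀ m {g h : ℕ → ℤ} → (∀ i → i <ₙ m → g i ≡ h i) → sumBelow m g ≡ sumBelow m h
sumBelow-cong zero    g≗h = refl
sumBelow-cong (suc m) g≗h =
  cong₂ _+_ (sumBelow-cong m (λ i i<m → g≗h i (ℕₚ.m<n⇒m<1+n i<m))) (g≗h m (ℕₚ.n<1+n m))

sumBelow-+ : ∀ m (g h : ℕ → ℤ) → sumBelow m (λ i → g i + h i) ≡ sumBelow m g + sumBelow m h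
sumBelow-+ zero    g h = refl
sumBelow-+ (suc m) g h rewrite sumBelow-+ m g h = +-interchange (sumBelow m g) (sumBelow m h) (g m) (h m)

sumBelow-neg : ∀ m (g : ℕ → ℤ) → sumBelow m (λ i → - g i) ≡ - sumBelow m g
sumBelow-neg zero    g = refl
sumBelow-neg (suc m) g rewrite sumBelow-neg m g = sym (ℤₚ.neg-distrib-+ (sumBelow m g) (g m))

sumBelow-indicator : ∀ m c U → sumBelow m (λ i → if i ≡ᵇ c then U else + 0) ≡ (if c <ᵇ m then U else + 0)
sumBelow-indicator zero    c U = refl
sumBelow-indicator (suc m) c U rewrite sumBelow-indicator m c U with ℕₚ.<-cmp c m
... | tri< c<m _ _ rewrite <ᵇ-true c<m | <ᵇ-true (ℕₚ.m<n⇒m<1+n c<m) | ≡ᵇ-false (ℕₚ.>⇒≢ c<m) =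
  ℤₚ.+-identityʳ U
... | tri≈ _ refl _ rewrite <ᵇ-false (ℕₚ.≤-refl {c}) | <ᵇ-true (ℕₚ.n<1+n c) | ≡ᵇ-true {c} refl =
  ℤₚ.+-identityˡ U
... | tri> _ _ m<c rewrite <ᵇ-false (ℕₚ.<⇒≤ m<c) | <ᵇ-false m<c | ≡ᵇ-false (ℕₚ.<⇒≢ m<c) = refl

τℕ : ℕ → ℕ → ℕ → ℤ
τℕ N a u = if a ≡ᵇ suc u then + 1 else if (a ≡ᵇ 0) ∧ (u ≡ᵇ N ∸ 1) then - (+ 1) else + 0

module _ {M : ℕ} (g : ℕ → ℤ) where

  private
    N = suc M

  τ-row-zero : sumFin {N} (λ x → τℕ N 0 (toℕ x) * g (toℕ x)) ≡ - g M
  τ-row-zero =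
    trans (sumFin-singleℕ (λ u → τℕ N 0 u * g u) M (ℕₚ.n<1+n M)
             (λ u _ u≢M → cong (λ b → (if b then - (+ 1) else + 0) * g u) (≡ᵇ-false u≢M)))
          (trans (cong (λ b → (if b then - (+ 1) else + 0) * g M) (≡ᵇ-true {M} refl))
                 (ℤₚ.-1*i≡-i (g M)))

  τ-row-suc : ∀ a → a <ₙ M → sumFin {N} (λ x → τℕ N (suc a) (toℕ x) * g (toℕ x)) ≡ g a
  τ-row-suc a a<M =
    trans (sumFin-singleℕ (λ u → τℕ N (suc a) u * g u) a (ℕₚ.m<n⇒m<1+n a<M)
             (λ u _ u≢a → cong (λ b → 𝟙 b * g u) (≡ᵇ-false (u≢a ∘ sym))))
          (trans (cong (λ b → 𝟙 b * g a) (≡ᵇ-true {a} refl))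
                 (ℤₚ.*-identityˡ (g a)))

  τ-col-last : sumFin {N} (λ x → τℕ N (toℕ x) M * g (toℕ x)) ≡ - g 0
  τ-col-last =
    trans (sumFin-singleℕ (λ u → τℕ N u M * g u) 0 (s≤s z≤n) others)
          (trans (cong (λ b → (if b then - (+ 1) else + 0) * g 0) (≡ᵇ-true {M} refl))
                 (ℤₚ.-1*i≡-i (g 0)))
    where
    others : ∀ u → u <ₙ N → u ≢ 0 → τℕ N u M * g u ≡ + 0
    others u u<N u≢0 rewrite ≡ᵇ-false (ℕₚ.<⇒≢ u<N) | ≡ᵇ-false u≢0 = refl

  τ-col : ∀ a → a <ₙ M → sumFin {N} (λ x → τℕ N (toℕ x) a * g (toℕ x)) ≡ g (suc a)
  τ-col a a<M =
    trans (sumFin-singleℕ (λ u → τℕ N u a * g u) (suc a) (s≤s a<M) others)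
          (trans (cong (λ b → 𝟙 b * g (suc a)) (≡ᵇ-true {a} refl))
                 (ℤₚ.*-identityˡ (g (suc a))))
    where
    others : ∀ u → u <ₙ N → u ≢ suc a → τℕ N u a * g u ≡ + 0
    others u _ u≢1+a
      rewrite ≡ᵇ-false u≢1+a | ≡ᵇ-false (ℕₚ.<⇒≢ a<M) | ∧-zeroʳ (u ≡ᵇ 0) = refl

-- τ^i sends e_l to e_{l+i}, or to -e_{l+i-N} once l + i wraps past N (for i ≤ N).
shiftEntry : ℕ → ℕ → ℕ → ℕ → ℤ
shiftEntry N i a l = if l +ₙ i ≡ᵇ a then + 1 else if l +ₙ i ≡ᵇ a +ₙ N then - (+ 1) else + 0

shiftEntry-suc-row : ∀ N i a l → shiftEntry N i a l ≡ shiftEntry N (suc i) (suc a) l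
shiftEntry-suc-row N i a l rewrite ℕₚ.+-suc l i = refl

shiftEntry-suc-col : ∀ N i l a → shiftEntry N i l (suc a) ≡ shiftEntry N (suc i) l a
shiftEntry-suc-col N i l a rewrite ℕₚ.+-suc a i = refl

shiftEntry-wrap-row : ∀ M i l → l <ₙ suc M → i ≤ₙ M →
                      - shiftEntry (suc M) i M l ≡ shiftEntry (suc M) (suc i) 0 l
shiftEntry-wrap-row M i l l<N i≤M
  rewrite ℕₚ.+-suc l i
        | ≡ᵇ-false {l +ₙ i} {M +ₙ suc M} (ℕₚ.<⇒≢ (ℕₚ.+-mono-≤-< (ℕₚ.≤-pred l<N) (s≤s i≤M)))
  with l +ₙ i ≡ᵇ M
... | true  = refl
... | false = refl

i+N≡M+1+i : ∀ M i → i +ₙ suc M ≡ M +ₙ suc i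
i+N≡M+1+i M i = trans (ℕₚ.+-comm i (suc M)) (sym (ℕₚ.+-suc M i))

shiftEntry-wrap-col : ∀ M i l → l <ₙ suc M → i ≤ₙ M →
                      - shiftEntry (suc M) i l 0 ≡ shiftEntry (suc M) (suc i) l M
shiftEntry-wrap-col M i l l<N i≤M
  rewrite ≡ᵇ-false {i} {l +ₙ suc M} (ℕₚ.<⇒≢ (ℕₚ.≤-trans (s≤s i≤M) (ℕₚ.m≤n+m (suc M) l)))
        | ≡ᵇ-false {M +ₙ suc i} {l}
            (ℕₚ.>⇒≢ (ℕₚ.<-≤-trans l<N (subst (suc M ≤ₙ_) (i+N≡M+1+i M i) (ℕₚ.m≤n+m (suc M) i))))
        | ≡ᵇ-cong {M +ₙ suc i} {l +ₙ suc M} {i} {l}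
            (λ e → ℕₚ.+-cancelʳ-≡ (suc M) i l (trans (i+N≡M+1+i M i) e))
            (λ e → trans (sym (i+N≡M+1+i M i)) (cong (_+ₙ suc M) e))
  with i ≡ᵇ l
... | true  = refl
... | false = refl

module _ {M : ℕ} where

  private
    N = suc M

  τ-pow-entry : ∀ i → i ≤ₙ N → (a l : Fin N) → matPow τ i a l ≡ shiftEntry N i (toℕ a) (toℕ l)
  τ-pow-entry zero _ a l
    rewrite ℕₚ.+-identityʳ (toℕ l)
          | ≡ᵇ-false {toℕ l} {toℕ a +ₙ N} (ℕₚ.<⇒≢ (ℕₚ.<-≤-trans (Finₚ.toℕ<n l) (ℕₚ.m≤n+m N (toℕ a))))
          | ≡ᵇ-cong {toℕ a} {toℕ l} {toℕ l} {toℕ a} sym sym = refl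
  τ-pow-entry (suc i) 1+i≤N a l =
    trans (sumFin-cong {N} {g = λ x → τℕ N (toℕ a) (toℕ x) * shiftEntry N i (toℕ x) (toℕ l)}
             (λ x → cong (τ a x *_) (τ-pow-entry i (ℕₚ.<⇒≤ 1+i≤N) x l)))
          (step a)
    where
    step : ∀ a → sumFin {N} (λ x → τℕ N (toℕ a) (toℕ x) * shiftEntry N i (toℕ x) (toℕ l))
                 ≡ shiftEntry N (suc i) (toℕ a) (toℕ l)
    step zero    = trans (τ-row-zero (λ u → shiftEntry N i u (toℕ l)))
                         (shiftEntry-wrap-row M i (toℕ l) (Finₚ.toℕ<n l) (ℕₚ.≤-pred 1+i≤N))
    step (suc a) = trans (τ-row-suc (λ u → shiftEntry N i u (toℕ l)) (toℕ a) (Finₚ.toℕ<n a))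
                         (shiftEntry-suc-row N i (toℕ a) (toℕ l))

  τ⁻¹-pow-entry : ∀ i → i ≤ₙ N → (a l : Fin N) → matPow τ⁻¹ i a l ≡ shiftEntry N i (toℕ l) (toℕ a)
  τ⁻¹-pow-entry zero _ a l
    rewrite ℕₚ.+-identityʳ (toℕ a)
          | ≡ᵇ-false {toℕ a} {toℕ l +ₙ N} (ℕₚ.<⇒≢ (ℕₚ.<-≤-trans (Finₚ.toℕ<n a) (ℕₚ.m≤n+m N (toℕ l)))) = refl
  τ⁻¹-pow-entry (suc i) 1+i≤N a l =
    trans (sumFin-cong {N} {g = λ x → τℕ N (toℕ x) (toℕ a) * shiftEntry N i (toℕ l) (toℕ x)}
             (λ x → cong (τ⁻¹ a x *_) (τ⁻¹-pow-entry i (ℕₚ.<⇒≤ 1+i≤N) x l)))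
          (step (ℕₚ.m≤n⇒m<n∨m≡n (ℕₚ.≤-pred (Finₚ.toℕ<n a))))
    where
    g : ℕ → ℤ
    g u = shiftEntry N i (toℕ l) u
    step : toℕ a <ₙ M ⊎ toℕ a ≡ M →
           sumFin {N} (λ x → τℕ N (toℕ x) (toℕ a) * g (toℕ x)) ≡ shiftEntry N (suc i) (toℕ l) (toℕ a)
    step (inj₁ a<M) = trans (τ-col {M} g (toℕ a) a<M) (shiftEntry-suc-col N i (toℕ l) (toℕ a))
    step (inj₂ a≡M) rewrite a≡M =
      trans (τ-col-last {M} g) (shiftEntry-wrap-col M i (toℕ l) (Finₚ.toℕ<n l) (ℕₚ.≤-pred 1+i≤N))

-- Cyclic difference (a - i) mod N, and the sign τ^i picks up when it wraps.
rotate : ℕ → ℕ → ℕ → ℕ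
rotate N i a = if i ≤ᵇ a then a ∸ i else a +ₙ N ∸ i

wrapSign : ℕ → ℕ → ℤ
wrapSign i a = if i ≤ᵇ a then + 1 else - (+ 1)

rotate< : ∀ N i a → i <ₙ N → a <ₙ N → rotate N i a <ₙ N
rotate< N i a i<N a<N with i ℕ.≤? a
... | yes i≤a rewrite ≤ᵇ-true i≤a = ℕₚ.≤-<-trans (ℕₚ.m∸n≤m a i) a<N
... | no i≰a rewrite ≤ᵇ-false (ℕₚ.≰⇒> i≰a) =
  subst (a +ₙ N ∸ i <ₙ_) (ℕₚ.m+n∸m≡n i N)
        (ℕₚ.∸-monoˡ-< (ℕₚ.+-monoˡ-< N (ℕₚ.≰⇒> i≰a)) (ℕₚ.≤-trans (ℕₚ.<⇒≤ i<N) (ℕₚ.m≤n+m N a)))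

rotate≢0 : ∀ N i a → i <ₙ N → i ≢ a → rotate N i a ≢ 0
rotate≢0 N i a i<N i≢a with i ℕ.≤? a
... | yes i≤a rewrite ≤ᵇ-true i≤a = ℕₚ.m>n⇒m∸n≢0 (ℕₚ.≤∧≢⇒< i≤a i≢a)
... | no i≰a rewrite ≤ᵇ-false (ℕₚ.≰⇒> i≰a) = ℕₚ.m>n⇒m∸n≢0 (ℕₚ.<-≤-trans i<N (ℕₚ.m≤n+m N a))

x+i≡ᵇc≡x≡ᵇc∸i : ∀ x i c → i ≤ₙ c → (x +ₙ i ≡ᵇ c) ≡ (x ≡ᵇ c ∸ i)
x+i≡ᵇc≡x≡ᵇc∸i x i c i≤c = ≡ᵇ-cong (λ e → trans (sym (ℕₚ.m+n∸n≡m x i)) (cong (_∸ i) e))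
                            (λ e → trans (cong (_+ₙ i) e) (ℕₚ.m∸n+n≡m i≤c))

shiftEntry-rotate : ∀ N i a x → i <ₙ N → a <ₙ N → x <ₙ N →
                    shiftEntry N i a x ≡ (if x ≡ᵇ rotate N i a then wrapSign i a else + 0)
shiftEntry-rotate N i a x i<N a<N x<N with i ℕ.≤? a
... | yes i≤a
  rewrite ≤ᵇ-true i≤a
        | ≡ᵇ-false {x +ₙ i} {a +ₙ N} (ℕₚ.<⇒≢ (subst (x +ₙ i <ₙ_) (ℕₚ.+-comm N a) (ℕₚ.+-mono-<-≤ x<N i≤a)))
        | x+i≡ᵇc≡x≡ᵇc∸i x i a i≤a = refl
... | no i≰a
  rewrite ≤ᵇ-false (ℕₚ.≰⇒> i≰a)
        | ≡ᵇ-false {x +ₙ i} {a} (λ e → i≰a (subst (i ≤ₙ_) e (ℕₚ.m≤n+m i x)))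
        | x+i≡ᵇc≡x≡ᵇc∸i x i (a +ₙ N) (ℕₚ.≤-trans (ℕₚ.<⇒≤ i<N) (ℕₚ.m≤n+m N a)) = refl

skewUnit : ℕ → ℕ → ℕ → ℤ
skewUnit K x y = if (x ≡ᵇ K) ∧ (y ≡ᵇ 0) then + 1 else if (x ≡ᵇ 0) ∧ (y ≡ᵇ K) then - (+ 1) else + 0

skewUnit-skew : ∀ K x y → K ≢ 0 → skewUnit K y x ≡ - skewUnit K x y
skewUnit-skew K x y K≢0 with x ≡ᵇ K in x≡K | x ≡ᵇ 0 in x≡0 | y ≡ᵇ K in y≡K | y ≡ᵇ 0 in y≡0
... | true  | true  | _     | _     = ⊥-elim (K≢0 (trans (sym (≡ᵇ-true⇒≡ {x} x≡K)) (≡ᵇ-true⇒≡ {x} x≡0)))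
... | _     | _     | true  | true  = ⊥-elim (K≢0 (trans (sym (≡ᵇ-true⇒≡ {y} y≡K)) (≡ᵇ-true⇒≡ {y} y≡0)))
... | true  | false | true  | false = refl
... | true  | false | false | true  = refl
... | true  | false | false | false = refl
... | false | true  | true  | false = refl
... | false | true  | false | true  = refl
... | false | true  | false | false = refl
... | false | false | true  | false = refl
... | false | false | false | true  = refl
... | false | false | false | false = refl

skewUnit-offAxis : ∀ K x y → x ≢ 0 → y ≢ 0 → skewUnit K x y ≡ + 0
skewUnit-offAxis K x y x≢0 y≢0 rewrite ≡ᵇ-false y≢0 | ∧-zeroʳ (x ≡ᵇ K) | ≡ᵇ-false x≢0 = refl

conjTerm : ∀ {N} → ℕ → ℕ → Mat N
conjTerm {N} k i = (matPow τ i ⊗ R N k) ⊗ matPow τ⁻¹ i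

module _ {M : ℕ} (k i : ℕ) (i<N : i <ₙ suc M) where

  private
    N = suc M

  conjTerm-entry : (a b : Fin N) →
    conjTerm k i a b ≡ (wrapSign i (toℕ a) * skewUnit (N ∸ k) (rotate N i (toℕ a)) (rotate N i (toℕ b)))
                       * wrapSign i (toℕ b)
  conjTerm-entry a b = begin
    sumFin (λ l → sumFin (λ x → matPow τ i a x * R N k x l) * matPow τ⁻¹ i l b)
      ≡⟨ sumFin-cong {N} (λ l → cong₂ _*_ (row l) (col l)) ⟩
    sumFin {N} (λ l → (wrapSign i A * skewUnit K ra (toℕ l)) * (if toℕ l ≡ᵇ rb then wrapSign i B else + 0))
      ≡⟨ sumFin-pickCol (λ u → wrapSign i A * skewUnit K ra u) rb (wrapSign i B)
                        (rotate< N i B i<N (Finₚ.toℕ<n b)) ⟩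
    (wrapSign i A * skewUnit K ra rb) * wrapSign i B ∎
    where
    open ≡-Reasoning
    A = toℕ a
    B = toℕ b
    K = N ∸ k
    ra = rotate N i A
    rb = rotate N i B
    τⁱ-entry : ∀ c x → matPow τ i c x ≡ (if toℕ x ≡ᵇ rotate N i (toℕ c) then wrapSign i (toℕ c) else + 0)
    τⁱ-entry c x = trans (τ-pow-entry i (ℕₚ.<⇒≤ i<N) c x)
                         (shiftEntry-rotate N i (toℕ c) (toℕ x) i<N (Finₚ.toℕ<n c) (Finₚ.toℕ<n x))
    row : ∀ l → sumFin (λ x → matPow τ i a x * R N k x l) ≡ wrapSign i A * skewUnit K ra (toℕ l)
    row l = trans (sumFin-cong {N} (λ x → cong (_* R N k x l) (τⁱ-entry a x)))
                  (sumFin-pickRow (λ u → skewUnit K u (toℕ l)) ra (wrapSign i A)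
                                  (rotate< N i A i<N (Finₚ.toℕ<n a)))
    col : ∀ l → matPow τ⁻¹ i l b ≡ (if toℕ l ≡ᵇ rb then wrapSign i B else + 0)
    col l = trans (τ⁻¹-pow-entry i (ℕₚ.<⇒≤ i<N) l b)
                  (shiftEntry-rotate N i B (toℕ l) i<N (Finₚ.toℕ<n b) (Finₚ.toℕ<n l))

  conjTerm-skew : k <ₙ N → (a b : Fin N) → conjTerm k i b a ≡ - conjTerm k i a b
  conjTerm-skew k<N a b = begin
    conjTerm k i b a                ≡⟨ conjTerm-entry b a ⟩
    (sb * skewUnit K rb ra) * sa    ≡⟨ cong (λ z → (sb * z) * sa) (skewUnit-skew K ra rb (ℕₚ.m>n⇒m∸n≢0 k<N)) ⟩
    (sb * - skewUnit K ra rb) * sa  ≡⟨ swap-neg sa sb (skewUnit K ra rb) ⟩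
    - ((sa * skewUnit K ra rb) * sb) ≡⟨ cong -_ (conjTerm-entry a b) ⟨
    - conjTerm k i a b              ∎
    where
    open ≡-Reasoning
    K = N ∸ k
    sa = wrapSign i (toℕ a)
    sb = wrapSign i (toℕ b)
    ra = rotate N i (toℕ a)
    rb = rotate N i (toℕ b)
    swap-neg : ∀ p q x → (q * - x) * p ≡ - ((p * x) * q)
    swap-neg = solve-∀

complement-≡ᵇ : ∀ N k A B → B <ₙ A → A <ₙ N → k <ₙ N → (B +ₙ N ∸ A ≡ᵇ N ∸ k) ≡ (A ∸ B ≡ᵇ k)
complement-≡ᵇ N k A B B<A A<N k<N =
  ≡ᵇ-cong (λ e → ℕₚ.∸-cancelˡ-≡ d≤N (ℕₚ.<⇒≤ k<N) (trans (sym B+N∸A≡N∸d) e))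
          (λ e → trans B+N∸A≡N∸d (cong (N ∸_) e))
  where
  d = A ∸ B
  d≤N : d ≤ₙ N
  d≤N = ℕₚ.≤-trans (ℕₚ.m∸n≤m A B) (ℕₚ.<⇒≤ A<N)
  B+N∸A≡N∸d : B +ₙ N ∸ A ≡ N ∸ d
  B+N∸A≡N∸d = begin
    B +ₙ N ∸ A          ≡⟨ cong (B +ₙ N ∸_) (ℕₚ.m+[n∸m]≡n (ℕₚ.<⇒≤ B<A)) ⟨
    B +ₙ N ∸ (B +ₙ d)  ≡⟨ ℕₚ.[m+n]∸[m+o]≡n∸o B N d ⟩
    N ∸ d               ∎
    where open ≡-Reasoning

-- Below the diagonal, τ^i R τ^{-i} is nonzero only for i ∈ {b, a}: then one of a, b is
-- rotated to 0 and the other to a - b (for i = b) or to b + N - a (for i = a).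
rotatedSkewUnit-below : ∀ N k i A B → k <ₙ N → i <ₙ N → B <ₙ A → A <ₙ N →
  (wrapSign i A * skewUnit (N ∸ k) (rotate N i A) (rotate N i B)) * wrapSign i B
    ≡ (if i ≡ᵇ B then 𝟙 (A ∸ B ≡ᵇ N ∸ k) else + 0) + (if i ≡ᵇ A then 𝟙 (A ∸ B ≡ᵇ k) else + 0)
rotatedSkewUnit-below N k i A B k<N i<N B<A A<N with i ℕ.≟ B | i ℕ.≟ A
... | yes refl | _
  rewrite ≤ᵇ-true (ℕₚ.≤-refl {i}) | ℕₚ.n∸n≡0 i | ≤ᵇ-true (ℕₚ.<⇒≤ B<A) | ≡ᵇ-true {i} refl
        | ≡ᵇ-false (ℕₚ.<⇒≢ B<A) | ≡ᵇ-false (ℕₚ.m>n⇒m∸n≢0 B<A)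
  with A ∸ i ≡ᵇ N ∸ k
... | true  = refl
... | false = refl
rotatedSkewUnit-below N k i A B k<N i<N B<A A<N | no i≢B | yes refl
  rewrite ≤ᵇ-true (ℕₚ.≤-refl {i}) | ℕₚ.n∸n≡0 i | ≤ᵇ-false B<A | ≡ᵇ-true {i} refl
        | ≡ᵇ-false i≢B | ≡ᵇ-false (≢-sym (ℕₚ.m>n⇒m∸n≢0 k<N))
        | complement-≡ᵇ N k i B B<A A<N k<N
  with i ∸ B ≡ᵇ k
... | true  = refl
... | false = refl
rotatedSkewUnit-below N k i A B k<N i<N B<A A<N | no i≢B | no i≢A
  rewrite ≡ᵇ-false i≢B | ≡ᵇ-false i≢A
        | skewUnit-offAxis (N ∸ k) (rotate N i A) (rotate N i B)
                           (rotate≢0 N i A i<N i≢A) (rotate≢0 N i B i<N i≢B)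
  = trans (cong (_* wrapSign i B) (ℤₚ.*-zeroʳ (wrapSign i A))) (ℤₚ.*-zeroˡ (wrapSign i B))

module _ {M : ℕ} (k : ℕ) (k<N : k <ₙ suc M) where

  private
    N = suc M

  conjSum-below : ∀ m → m ≤ₙ N → (a b : Fin N) → toℕ b <ₙ toℕ a →
    conjSum N k m a b ≡ (if toℕ b <ᵇ m then 𝟙 (toℕ a ∸ toℕ b ≡ᵇ N ∸ k) else + 0)
                      + (if toℕ a <ᵇ m then 𝟙 (toℕ a ∸ toℕ b ≡ᵇ k) else + 0)
  conjSum-below m m≤N a b b<a = begin
    conjSum N k m a b
      ≡⟨ sumMat-apply m (conjTerm k) a b ⟩
    sumBelow m (λ i → conjTerm k i a b)
      ≡⟨ sumBelow-cong m (λ i i<m → let i<N = ℕₚ.<-≤-trans i<m m≤N in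
           trans (conjTerm-entry k i i<N a b) (rotatedSkewUnit-below N k i A B k<N i<N b<a (Finₚ.toℕ<n a))) ⟩
    sumBelow m (λ i → (if i ≡ᵇ B then 𝟙 (A ∸ B ≡ᵇ N ∸ k) else + 0) + (if i ≡ᵇ A then 𝟙 (A ∸ B ≡ᵇ k) else + 0))
      ≡⟨ sumBelow-+ m _ _ ⟩
    sumBelow m (λ i → if i ≡ᵇ B then 𝟙 (A ∸ B ≡ᵇ N ∸ k) else + 0)
      + sumBelow m (λ i → if i ≡ᵇ A then 𝟙 (A ∸ B ≡ᵇ k) else + 0)
      ≡⟨ cong₂ _+_ (sumBelow-indicator m B _) (sumBelow-indicator m A _) ⟩
    (if B <ᵇ m then 𝟙 (A ∸ B ≡ᵇ N ∸ k) else + 0) + (if A <ᵇ m then 𝟙 (A ∸ B ≡ᵇ k) else + 0) ∎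
    where
    open ≡-Reasoning
    A = toℕ a
    B = toℕ b

  conjSum-skew : ∀ m → m ≤ₙ N → (a b : Fin N) → conjSum N k m b a ≡ - conjSum N k m a b
  conjSum-skew m m≤N a b = begin
    conjSum N k m b a
      ≡⟨ sumMat-apply m (conjTerm k) b a ⟩
    sumBelow m (λ i → conjTerm k i b a)
      ≡⟨ sumBelow-cong m (λ i i<m → conjTerm-skew k i (ℕₚ.<-≤-trans i<m m≤N) k<N a b) ⟩
    sumBelow m (λ i → - conjTerm k i a b)
      ≡⟨ sumBelow-neg m (λ i → conjTerm k i a b) ⟩
    - sumBelow m (λ i → conjTerm k i a b)
      ≡⟨ cong -_ (sumMat-apply m (conjTerm k) a b) ⟨
    - conjSum N k m a b ∎
    where open ≡-Reasoning

*2≡+ : ∀ k → k *ₙ 2 ≡ k +ₙ k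
*2≡+ = ℕ-Solver.solve-∀

module _ (N : ℕ) where

  private
    r = half N

  half-spec : N ≡ N ℕ.% 2 +ₙ (r +ₙ r)
  half-spec = trans (ℕ.m≡m%n+[m/n]*n N 2) (cong (N ℕ.% 2 +ₙ_) (*2≡+ r))

  half+half≤ : r +ₙ r ≤ₙ N
  half+half≤ = subst (r +ₙ r ≤ₙ_) (sym half-spec) (ℕₚ.m≤n+m (r +ₙ r) (N ℕ.% 2))

  ≤1+half+half : N ≤ₙ suc (r +ₙ r)
  ≤1+half+half = subst (_≤ₙ suc (r +ₙ r)) (sym half-spec) (ℕₚ.+-monoˡ-≤ (r +ₙ r) (ℕₚ.≤-pred (ℕ.m%n<n N 2)))

  even⇒half+half : N ℕ.% 2 ≡ 0 → N ≡ r +ₙ r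
  even⇒half+half even = trans half-spec (cong (_+ₙ (r +ₙ r)) even)

  ≤half⇒< : ∀ {k} → 1 ≤ₙ k → k ≤ₙ r → k <ₙ N
  ≤half⇒< {k} 1≤k k≤r =
    ℕₚ.<-≤-trans (ℕₚ.+-mono-<-≤ (ℕₚ.<-≤-trans (ℕₚ.n<1+n 0) 1≤k) k≤r)
      (ℕₚ.≤-trans (ℕₚ.+-monoˡ-≤ r k≤r) half+half≤)

suc-toℕ<N : ∀ N (k : Fin (half N)) → suc (toℕ k) <ₙ N
suc-toℕ<N N k = ≤half⇒< N (s≤s z≤n) (Finₚ.toℕ<n k)

isMiddle : ℕ → ℕ → Bool
isMiddle N k = ((N ℕ.% 2) ≡ᵇ 0) ∧ (k ≡ᵇ half N)

k+k-isMiddle : ∀ k → isMiddle (k +ₙ k) k ≡ true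
k+k-isMiddle k rewrite sym (*2≡+ k) | ℕ.m*n%n≡0 k 2 ⦃ _ ⦄ | ℕ.m*n/n≡m k 2 ⦃ _ ⦄ = ≡ᵇ-true {k} refl

half≤ : ∀ N → half N ≤ₙ N
half≤ N = ℕₚ.≤-trans (ℕₚ.m≤m+n (half N) (half N)) (half+half≤ N)

∧≡true : ∀ {x y} → x ∧ y ≡ true → x ≡ true × y ≡ true
∧≡true {true} {true} refl = refl , refl

module _ {M : ℕ} (k : ℕ) (k<N : k <ₙ suc M) (a b : Fin (suc M)) (b<a : toℕ b <ₙ toℕ a) where

  private
    N = suc M
    d = toℕ a ∸ toℕ b

  conjSum-full-below : k ≢ N ∸ k → conjSum N k N a b ≡ 𝟙 ((d ≡ᵇ k) ∨ (d ≡ᵇ N ∸ k))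
  conjSum-full-below k≢N∸k
    rewrite conjSum-below k k<N N ℕₚ.≤-refl a b b<a | <ᵇ-true (Finₚ.toℕ<n a) | <ᵇ-true (Finₚ.toℕ<n b)
    with d ≡ᵇ N ∸ k in d≡N∸k | d ≡ᵇ k in d≡k
  ... | true  | true  = ⊥-elim (k≢N∸k (trans (sym (≡ᵇ-true⇒≡ {d} d≡k)) (≡ᵇ-true⇒≡ {d} d≡N∸k)))
  ... | true  | false = refl
  ... | false | true  = refl
  ... | false | false = refl

  module _ (N≡k+k : N ≡ k +ₙ k) (d≡k : d ≡ k) where

    a≡b+k : toℕ a ≡ toℕ b +ₙ k
    a≡b+k = trans (sym (ℕₚ.m+[n∸m]≡n (ℕₚ.<⇒≤ b<a))) (cong (toℕ b +ₙ_) d≡k)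

    k≤a : k ≤ₙ toℕ a
    k≤a = subst (k ≤ₙ_) (sym a≡b+k) (ℕₚ.m≤n+m k (toℕ b))

    b<k : toℕ b <ₙ k
    b<k = ℕₚ.+-cancelʳ-< k (toℕ b) k
            (subst (_<ₙ k +ₙ k) a≡b+k (ℕₚ.<-≤-trans (Finₚ.toℕ<n a) (ℕₚ.≤-reflexive N≡k+k)))

  conjSum-half-below : N ≡ k +ₙ k → conjSum N k k a b ≡ 𝟙 ((d ≡ᵇ k) ∨ (d ≡ᵇ N ∸ k))
  conjSum-half-below N≡k+k
    rewrite conjSum-below k k<N k (ℕₚ.<⇒≤ k<N) a b b<a
          | trans (cong (_∸ k) N≡k+k) (ℕₚ.m+n∸n≡m k k)
    with d ≡ᵇ k in d≡k
  ... | true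
    rewrite <ᵇ-true (b<k N≡k+k (≡ᵇ-true⇒≡ {d} d≡k)) | <ᵇ-false (k≤a N≡k+k (≡ᵇ-true⇒≡ {d} d≡k)) = refl
  ... | false with toℕ b <ᵇ k | toℕ a <ᵇ k
  ...   | true  | true  = refl
  ...   | true  | false = refl
  ...   | false | true  = refl
  ...   | false | false = refl

module _ {M : ℕ} (k : ℕ) (k<N : k <ₙ suc M) where

  private
    N = suc M

  Bprim-skew : (a b : Fin N) → Bprim N k b a ≡ - Bprim N k a b
  Bprim-skew a b with isMiddle N k
  ... | true  = conjSum-skew k k<N (half N) (half≤ N) a b
  ... | false = conjSum-skew k k<N N ℕₚ.≤-refl a b

  Bprim-below : (a b : Fin N) → toℕ b <ₙ toℕ a →
                Bprim N k a b ≡ 𝟙 ((toℕ a ∸ toℕ b ≡ᵇ k) ∨ (toℕ a ∸ toℕ b ≡ᵇ N ∸ k))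
  Bprim-below a b b<a with isMiddle N k in middle
  ... | false = conjSum-full-below k k<N a b b<a λ k≡N∸k →
    case trans (sym (k+k-isMiddle k)) (subst (λ X → isMiddle X k ≡ false) (N≡k+k k≡N∸k) middle) of λ ()
    where
    N≡k+k : k ≡ N ∸ k → N ≡ k +ₙ k
    N≡k+k k≡N∸k = trans (sym (ℕₚ.m∸n+n≡m (ℕₚ.<⇒≤ k<N))) (cong (_+ₙ k) (sym k≡N∸k))
  ... | true with ∧≡true middle
  ...   | even , k≡ᵇr =
    subst (λ m → conjSum N k m a b ≡ 𝟙 ((toℕ a ∸ toℕ b ≡ᵇ k) ∨ (toℕ a ∸ toℕ b ≡ᵇ N ∸ k))) k≡r
          (conjSum-half-below k k<N a b b<a N≡k+k)
    where
    k≡r : k ≡ half N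
    k≡r = ≡ᵇ-true⇒≡ k≡ᵇr
    N≡k+k : N ≡ k +ₙ k
    N≡k+k = trans (even⇒half+half N (≡ᵇ-true⇒≡ even)) (cong (λ x → x +ₙ x) (sym k≡r))

both≤half⇒≡ : ∀ {a b r N} → a ≤ₙ r → b ≤ₙ r → r +ₙ r ≤ₙ N → a +ₙ b ≡ N → a ≡ b
both≤half⇒≡ {a} {b} {r} a≤r b≤r r+r≤N a+b≡N = trans (ℕₚ.≤-antisym a≤r r≤a) (ℕₚ.≤-antisym r≤b b≤r)
  where
  r+r≤a+b : r +ₙ r ≤ₙ a +ₙ b
  r+r≤a+b = ℕₚ.≤-trans r+r≤N (ℕₚ.≤-reflexive (sym a+b≡N))
  r≤a : r ≤ₙ a
  r≤a = ℕₚ.+-cancelʳ-≤ r r a (ℕₚ.≤-trans r+r≤a+b (ℕₚ.+-monoʳ-≤ a b≤r))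
  r≤b : r ≤ₙ b
  r≤b = ℕₚ.+-cancelˡ-≤ r r b (ℕₚ.≤-trans r+r≤a+b (ℕₚ.+-monoˡ-≤ b a≤r))

module _ (N r : ℕ) (r+r≤N : r +ₙ r ≤ₙ N) (N≤1+r+r : N ≤ₙ suc (r +ₙ r)) (c : ℕ → ℤ)
         (palindromic : ∀ y → suc y <ₙ N → c (suc y) ≡ c (N ∸ suc y)) where

  private
    <r⇒<N : ∀ {u} → u <ₙ r → u <ₙ N
    <r⇒<N u<r = ℕₚ.<-≤-trans u<r (ℕₚ.≤-trans (ℕₚ.m≤m+n r r) r+r≤N)

    term : ℕ → ℕ → ℤ
    term d u = c (suc u) * 𝟙 ((d ≡ᵇ suc u) ∨ (d ≡ᵇ N ∸ suc u))

    term-vanishes : ∀ d u → d ≢ suc u → d ≢ N ∸ suc u → term d u ≡ + 0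
    term-vanishes d u d≢1+u d≢N∸1+u rewrite ≡ᵇ-false d≢1+u | ≡ᵇ-false d≢N∸1+u = ℤₚ.*-zeroʳ (c (suc u))

    coefficient-low : ∀ e → suc e ≤ₙ r → sumFin {r} (term (suc e) ∘ toℕ) ≡ c (suc e)
    coefficient-low e 1+e≤r =
      trans (sumFin-singleℕ (term (suc e)) e 1+e≤r others)
            (trans (cong (λ b → c (suc e) * 𝟙 (b ∨ (suc e ≡ᵇ N ∸ suc e))) (≡ᵇ-true {e} refl))
                   (ℤₚ.*-identityʳ (c (suc e))))
      where
      others : ∀ u → u <ₙ r → u ≢ e → term (suc e) u ≡ + 0
      others u u<r u≢e = term-vanishes (suc e) u (u≢e ∘ sym ∘ ℕₚ.suc-injective) λ 1+e≡N∸1+u →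
        u≢e (ℕₚ.suc-injective (sym (both≤half⇒≡ 1+e≤r u<r r+r≤N
          (trans (cong (_+ₙ suc u) 1+e≡N∸1+u) (ℕₚ.m∸n+n≡m (<r⇒<N u<r))))))

    coefficient-high : ∀ d → r <ₙ d → d <ₙ N → sumFin {r} (term d ∘ toℕ) ≡ c (N ∸ d)
    coefficient-high d r<d d<N =
      trans (sumFin-singleℕ (term d) v v<r others)
            (trans (cong (λ b → c (suc v) * 𝟙 ((d ≡ᵇ suc v) ∨ b)) (≡ᵇ-true (sym N∸1+v≡d)))
            (trans (cong (λ b → c (suc v) * 𝟙 b) (∨-zeroʳ (d ≡ᵇ suc v)))
            (trans (ℤₚ.*-identityʳ (c (suc v))) (cong c 1+v≡N∸d))))
      where
      v = N ∸ suc d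
      1+v≡N∸d : suc v ≡ N ∸ d
      1+v≡N∸d = sym (ℕₚ.+-∸-assoc 1 d<N)
      N∸1+v≡d : N ∸ suc v ≡ d
      N∸1+v≡d = trans (cong (N ∸_) 1+v≡N∸d) (ℕₚ.m∸[m∸n]≡n (ℕₚ.<⇒≤ d<N))
      v<r : v <ₙ r
      v<r = subst (_≤ₙ r) (sym 1+v≡N∸d)
              (ℕₚ.m≤n+o⇒m∸n≤o N d (ℕₚ.≤-trans N≤1+r+r (ℕₚ.+-monoˡ-≤ r r<d)))
      others : ∀ u → u <ₙ r → u ≢ v → term d u ≡ + 0
      others u u<r u≢v = term-vanishes d u (λ d≡1+u → ℕₚ.<⇒≱ r<d (subst (_≤ₙ r) (sym d≡1+u) u<r))
        λ d≡N∸1+u → u≢v (ℕₚ.suc-injective (trans (sym (ℕₚ.m∸[m∸n]≡n (<r⇒<N u<r)))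
                                                  (trans (cong (N ∸_) (sym d≡N∸1+u)) (sym 1+v≡N∸d))))

  palindromic-expansion : ∀ d → 0 <ₙ d → d <ₙ N →
    sumFin {r} (λ k → c (suc (toℕ k)) * 𝟙 ((d ≡ᵇ suc (toℕ k)) ∨ (d ≡ᵇ N ∸ suc (toℕ k)))) ≡ c d
  palindromic-expansion (suc e) _ d<N with suc e ℕ.≤? r
  ... | yes 1+e≤r = coefficient-low e 1+e≤r
  ... | no 1+e≰r  = trans (coefficient-high (suc e) (ℕₚ.≰⇒> 1+e≰r) d<N) (sym (palindromic e d<N))

≡-neg⇒≡0 : ∀ x → x ≡ - x → x ≡ + 0
≡-neg⇒≡0 (+ zero)    _ = refl
≡-neg⇒≡0 (+ suc n)   ()
≡-neg⇒≡0 ℤ.-[1+ n ] ()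

SkewSymmetric-combination : ∀ {N r} (w : Fin r → ℤ) (A : Fin r → Mat N) → (∀ k → SkewSymmetric (A k)) →
                            SkewSymmetric (λ i j → sumFin (λ k → w k * A k i j))
SkewSymmetric-combination w A skew i j =
  trans (sumFin-cong (λ k → trans (cong (w k *_) (skew k i j)) (sym (ℤₚ.neg-distribʳ-* (w k) _))))
        (sumFin-neg (λ k → w k * A k i j))

SkewSymmetric-≡-below : ∀ {N} {A C : Mat N} → SkewSymmetric A → SkewSymmetric C →
                        (∀ i j → toℕ j <ₙ toℕ i → A i j ≡ C i j) → ∀ i j → A i j ≡ C i j
SkewSymmetric-≡-below {A = A} {C} skewA skewC below i j with ℕₚ.<-cmp (toℕ i) (toℕ j)
... | tri> _ _ j<i = below i j j<i
... | tri< i<j _ _ = trans (skewA j i) (trans (cong -_ (below j i i<j)) (sym (skewC j i)))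
... | tri≈ _ i≡j _ with Finₚ.toℕ-injective {i = i} {j} i≡j
...   | refl = trans (≡-neg⇒≡0 (A i i) (skewA i i)) (sym (≡-neg⇒≡0 (C i i) (skewC i i)))

μ-sink : ∀ {N} (B : Mat N) k i j → SkewSymmetric B → (∀ j → B k j ≤ + 0) →
         toℕ i ≢ toℕ k → toℕ j ≢ toℕ k → μ k B i j ≡ B i j
μ-sink B k i j skew sink i≢k j≢k rewrite ≡ᵇ-false i≢k | ≡ᵇ-false j≢k =
  trans (cong (λ z → B i j + (z /ℕ 2)) correction≡0) (ℤₚ.+-identityʳ (B i j))
  where
  open ≡-Reasoning
  s = B k i
  t = B k j
  ∣s∣ : absℤ (- s) ≡ - s
  ∣s∣ = ℤₚ.0≤i⇒+∣i∣≡i (ℤₚ.neg-mono-≤ (sink i))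
  ∣t∣ : absℤ t ≡ - t
  ∣t∣ = trans (cong +_ (sym (ℤₚ.∣-i∣≡∣i∣ t))) (ℤₚ.0≤i⇒+∣i∣≡i (ℤₚ.neg-mono-≤ (sink j)))
  cancel : ∀ x y → (- x) * y + (- x) * (- y) ≡ + 0
  cancel = solve-∀
  correction≡0 : absℤ (B i k) * t + B i k * absℤ t ≡ + 0
  correction≡0 = begin
    absℤ (B i k) * t + B i k * absℤ t  ≡⟨ cong (λ z → absℤ z * t + z * absℤ t) (skew k i) ⟩
    absℤ (- s) * t + (- s) * absℤ t    ≡⟨ cong₂ (λ u v → u * t + (- s) * v) ∣s∣ ∣t∣ ⟩
    (- s) * t + (- s) * (- t)          ≡⟨ cancel s t ⟩
    + 0                                ∎

cyclePred : ∀ {M} → Fin (suc M) → Fin (suc M)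
cyclePred {M} zero = fromℕ M
cyclePred (suc a)  = inject₁ a

ρ-row : ∀ {M} (g : Fin (suc M) → ℤ) a → sumFin (λ x → ρ a x * g x) ≡ g (cyclePred a)
ρ-row {M} g zero =
  trans (sumFin-single (λ x → ρ zero x * g x) (fromℕ M) others)
        (trans (cong (λ b → 𝟙 b * g (fromℕ M)) (≡ᵇ-true (Finₚ.toℕ-fromℕ M))) (ℤₚ.*-identityˡ _))
  where
  others : ∀ l → l ≢ fromℕ M → ρ zero l * g l ≡ + 0
  others l l≢M rewrite ≡ᵇ-false {toℕ l} {M}
    (λ e → l≢M (Finₚ.toℕ-injective (trans e (sym (Finₚ.toℕ-fromℕ M))))) = refl
ρ-row {M} g (suc a) =
  trans (sumFin-single (λ x → ρ (suc a) x * g x) (inject₁ a) others)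
        (trans (cong (λ b → 𝟙 b * g (inject₁ a)) (≡ᵇ-true (sym (Finₚ.toℕ-inject₁ a)))) (ℤₚ.*-identityˡ _))
  where
  others : ∀ l → l ≢ inject₁ a → ρ (suc a) l * g l ≡ + 0
  others l l≢a rewrite ≡ᵇ-false {toℕ a} {toℕ l}
    (λ e → l≢a (Finₚ.toℕ-injective (trans (sym e) (sym (Finₚ.toℕ-inject₁ a))))) = refl

ρ-conj : ∀ {M} (X : Mat (suc M)) a b → ((ρ ⊗ X) ⊗ ρ⁻¹) a b ≡ X (cyclePred a) (cyclePred b)
ρ-conj X a b =
  trans (sumFin-cong (λ l → trans (cong (_* ρ b l) (ρ-row (λ x → X x l) a))
                                  (ℤₚ.*-comm (X (cyclePred a) l) (ρ b l))))
        (ρ-row (X (cyclePred a)) b)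

module _ {K : ℕ} ⦃ _ : ℕ.NonZero K ⦄ where

  toℕ-mod : ∀ x → x <ₙ K → toℕ (x ℕ.mod K) ≡ x
  toℕ-mod x x<K = trans (Finₚ.toℕ-fromℕ< (ℕ.m%n<n x K)) (ℕ.m<n⇒m%n≡m x<K)

  toℕ-mod-toℕ : ∀ (a : Fin K) → toℕ a ℕ.mod K ≡ a
  toℕ-mod-toℕ a = Finₚ.toℕ-injective (toℕ-mod (toℕ a) (Finₚ.toℕ<n a))

module PeriodOneSink {n : ℕ} (B : Mat (suc (suc n))) (skew : SkewSymmetric B)
                     (period : ∀ i j → μ zero B i j ≡ ((ρ ⊗ B) ⊗ ρ⁻¹) i j)
                     (sink : ∀ j → B zero j ≤ + 0) where

  private
    M N : ℕ
    M = suc n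
    N = suc M

  Bℕ : ℕ → ℕ → ℤ
  Bℕ x y = B (x ℕ.mod N) (y ℕ.mod N)

  private
    suc-mod : ∀ x → x <ₙ M → suc (x ℕ.mod M) ≡ suc x ℕ.mod N
    suc-mod x x<M =
      Finₚ.toℕ-injective (trans (cong suc (toℕ-mod x x<M)) (sym (toℕ-mod (suc x) (s≤s x<M))))

    inject₁-mod : ∀ x → x <ₙ M → inject₁ (x ℕ.mod M) ≡ x ℕ.mod N
    inject₁-mod x x<M = Finₚ.toℕ-injective
      (trans (Finₚ.toℕ-inject₁ (x ℕ.mod M)) (trans (toℕ-mod x x<M) (sym (toℕ-mod x (ℕₚ.m<n⇒m<1+n x<M)))))

    fromℕ-mod : fromℕ M ≡ M ℕ.mod N
    fromℕ-mod = Finₚ.toℕ-injective (trans (Finₚ.toℕ-fromℕ M) (sym (toℕ-mod M (ℕₚ.n<1+n M))))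

  Bℕ-shift : ∀ x y → x <ₙ M → y <ₙ M → Bℕ (suc x) (suc y) ≡ Bℕ x y
  Bℕ-shift x y x<M y<M = begin
    B (suc x ℕ.mod N) (suc y ℕ.mod N)  ≡⟨ cong₂ B (suc-mod x x<M) (suc-mod y y<M) ⟨
    B (suc p) (suc q)                   ≡⟨ μ-sink B zero (suc p) (suc q) skew sink (λ ()) (λ ()) ⟨
    μ zero B (suc p) (suc q)            ≡⟨ period (suc p) (suc q) ⟩
    ((ρ ⊗ B) ⊗ ρ⁻¹) (suc p) (suc q)     ≡⟨ ρ-conj B (suc p) (suc q) ⟩
    B (inject₁ p) (inject₁ q)           ≡⟨ cong₂ B (inject₁-mod x x<M) (inject₁-mod y y<M) ⟩
    B (x ℕ.mod N) (y ℕ.mod N)           ∎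
    where
    open ≡-Reasoning
    p = x ℕ.mod M
    q = y ℕ.mod M

  Bℕ-wrap : ∀ y → y <ₙ M → - Bℕ 0 (suc y) ≡ Bℕ M y
  Bℕ-wrap y y<M = begin
    - B zero (suc y ℕ.mod N)          ≡⟨ cong (λ j → - B zero j) (suc-mod y y<M) ⟨
    μ zero B zero (suc q)              ≡⟨ period zero (suc q) ⟩
    ((ρ ⊗ B) ⊗ ρ⁻¹) zero (suc q)       ≡⟨ ρ-conj B zero (suc q) ⟩
    B (fromℕ M) (inject₁ q)            ≡⟨ cong₂ B fromℕ-mod (inject₁-mod y y<M) ⟩
    B (M ℕ.mod N) (y ℕ.mod N)          ∎
    where
    open ≡-Reasoning
    q = y ℕ.mod M

  Bℕ-toeplitz : ∀ y d → y +ₙ d ≤ₙ M → Bℕ (y +ₙ d) y ≡ Bℕ d 0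
  Bℕ-toeplitz zero    d _     = refl
  Bℕ-toeplitz (suc y) d y+d<M =
    trans (Bℕ-shift (y +ₙ d) y y+d<M (ℕₚ.<-≤-trans (s≤s (ℕₚ.m≤m+n y d)) y+d<M))
          (Bℕ-toeplitz y d (ℕₚ.<⇒≤ y+d<M))

  symbol : ℕ → ℤ
  symbol d = Bℕ d 0

  symbol-nonneg : ∀ d → + 0 ≤ symbol d
  symbol-nonneg d = subst (+ 0 ≤_) (sym (skew zero (d ℕ.mod N))) (ℤₚ.neg-mono-≤ (sink (d ℕ.mod N)))

  symbol-palindromic : ∀ y → suc y <ₙ N → symbol (suc y) ≡ symbol (N ∸ suc y)
  symbol-palindromic y (s≤s y<M) = begin
    Bℕ (suc y) 0             ≡⟨ skew zero (suc y ℕ.mod N) ⟩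
    - Bℕ 0 (suc y)           ≡⟨ Bℕ-wrap y y<M ⟩
    Bℕ M y                   ≡⟨ cong (λ x → Bℕ x y) (ℕₚ.m+[n∸m]≡n (ℕₚ.<⇒≤ y<M)) ⟨
    Bℕ (y +ₙ (M ∸ y)) y      ≡⟨ Bℕ-toeplitz y (M ∸ y) (ℕₚ.≤-reflexive (ℕₚ.m+[n∸m]≡n (ℕₚ.<⇒≤ y<M))) ⟩
    Bℕ (M ∸ y) 0             ∎
    where open ≡-Reasoning

  B-below : ∀ a b → toℕ b <ₙ toℕ a → B a b ≡ symbol (toℕ a ∸ toℕ b)
  B-below a b b<a = begin
    B a b                                  ≡⟨ cong₂ B (toℕ-mod-toℕ a) (toℕ-mod-toℕ b) ⟨
    Bℕ (toℕ a) (toℕ b)                     ≡⟨ cong (λ x → Bℕ x (toℕ b)) b+d≡a ⟨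
    Bℕ (toℕ b +ₙ (toℕ a ∸ toℕ b)) (toℕ b)  ≡⟨ Bℕ-toeplitz (toℕ b) _ b+d≤M ⟩
    symbol (toℕ a ∸ toℕ b)                 ∎
    where
    open ≡-Reasoning
    b+d≡a : toℕ b +ₙ (toℕ a ∸ toℕ b) ≡ toℕ a
    b+d≡a = ℕₚ.m+[n∸m]≡n (ℕₚ.<⇒≤ b<a)
    b+d≤M : toℕ b +ₙ (toℕ a ∸ toℕ b) ≤ₙ M
    b+d≤M = subst (_≤ₙ M) (sym b+d≡a) (ℕₚ.≤-pred (Finₚ.toℕ<n a))

  multiplicity : Fin (half N) → ℕ
  multiplicity k = ∣ symbol (suc (toℕ k)) ∣

  B-expansion-below : ∀ a b → toℕ b <ₙ toℕ a →
                      B a b ≡ sumFin (λ k → + multiplicity k * Bprim N (suc (toℕ k)) a b)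
  B-expansion-below a b b<a = begin
    B a b
      ≡⟨ B-below a b b<a ⟩
    symbol d
      ≡⟨ palindromic-expansion N r (half+half≤ N) (≤1+half+half N) symbol symbol-palindromic
           d (ℕₚ.m<n⇒0<n∸m b<a) (ℕₚ.≤-<-trans (ℕₚ.m∸n≤m (toℕ a) (toℕ b)) (Finₚ.toℕ<n a)) ⟨
    sumFin {r} (λ k → symbol (suc (toℕ k)) * 𝟙 ((d ≡ᵇ suc (toℕ k)) ∨ (d ≡ᵇ N ∸ suc (toℕ k))))
      ≡⟨ sumFin-cong (λ k → cong₂ _*_ (sym (ℤₚ.0≤i⇒+∣i∣≡i (symbol-nonneg (suc (toℕ k)))))
                                       (sym (Bprim-below (suc (toℕ k)) (suc-toℕ<N N k) a b b<a))) ⟩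
    sumFin (λ k → + multiplicity k * Bprim N (suc (toℕ k)) a b) ∎
    where
    open ≡-Reasoning
    r = half N
    d = toℕ a ∸ toℕ b

mainTheorem2 : (n : ℕ) → (B : Mat (suc (suc n))) → SkewSymmetric B
    → (∀ i j → μ zero B i j ≡ ((ρ ⊗ B) ⊗ ρ⁻¹) i j)
    → (∀ j → B zero j ≤ + 0)
    → ∃ λ (m : Fin (half (suc (suc n))) → ℕ) →
        ∀ i j → B i j ≡ sumFin (λ k → + (m k) * Bprim (suc (suc n)) (suc (toℕ k)) i j)
mainTheorem2 n B skew period sink =
  multiplicity , SkewSymmetric-≡-below skew combination-skew B-expansion-below
  where
  open PeriodOneSink B skew period sink
  N = suc (suc n)
  combination-skew : SkewSymmetric (λ i j → sumFin (λ k → + multiplicity k * Bprim N (suc (toℕ k)) i j))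
  combination-skew = SkewSymmetric-combination (λ k → + multiplicity k) (λ k → Bprim N (suc (toℕ k)))
                       (λ k → Bprim-skew (suc (toℕ k)) (suc-toℕ<N N k))
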